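{- Let $n,a,b$ be positive integers with $a+b<n$ and $a>b$, and let $\sigma$ be a uniformly random permutation of $\{1,\ldots,n\}$. Then $\Pr[D_{a,b}(\sigma)=0]\le\frac1{2(n-a-b+1)}$.
   Context: For positive integers $a,b$ with $a+b<n$ and a permutation $\sigma$ of $\{1,\ldots,n\}$, define $D_{a,b}(\sigma)=\sum_{i=1}^{a}\sigma(i)-\sum_{i=a+1}^{a+b}\sigma(i)$. -}

module Defs where

open import Data.Nat using (ℕ; zero; suc; _+_; _∸_)
open import Data.Integer using (ℤ; +_; _-_)
open import Data.List using (List; []; _∷_; concatMap; map; length; take; drop; filter)
open import Data.Nat.Properties using (_≟_)
open import Relation.Binary.PropositionalEquality using (_≡_)
import Data.Integer.Properties as ℤP
open import Data.Nat.ListAction using (sum)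

-- A permutation σ of {1,…,n} is represented by its list of values
-- [σ(1), σ(2), …, σ(n)].

insertions : ℕ → List ℕ → List (List ℕ)
insertions x [] = (x ∷ []) ∷ []
insertions x (y ∷ ys) = (x ∷ y ∷ ys) ∷ map (y ∷_) (insertions x ys)

perms : ℕ → List (List ℕ)
perms zero = [] ∷ []
perms (suc n) = concatMap (insertions (suc n)) (perms n)

D : ℕ → ℕ → List ℕ → ℤ
D a b σ = + sum (take a σ) - + sum (take b (drop a σ))

countZero : ℕ → ℕ → ℕ → ℕ
countZero n a b = length (filter (λ σ → D a b σ ℤP.≟ + 0) (perms n))

-- Let Z be the set of σ with D_{a,b}(σ) = 0, N = n + 1 and k = n - a - b.  Send
-- (σ, e, t) ∈ Z × {plain, complemented} × {0, …, k} to the permutation obtained from σ (or from its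
-- complement N - σ) by exchanging the first entry with the entry at position a + b + t when t > 0,
-- a position outside both blocks.  For σ ∈ Z the first block minus the second sums to 0, for its
-- complement to (a - b) N.  The exchange leaves positions 2, …, a + b untouched, so the image τ
-- determines the value v that the first entry had: v + Σ_{i=2}^{a} τ(i) = Σ_{i=a+1}^{a+b} τ(i)
-- plus 0 or (a - b) N.  These two candidates differ by more than n, so only one lies in {1, …, n},
-- which fixes e; the entries of τ are distinct, so v fixes t; exchanging back and complementing
-- recovers σ.  Hence the map is injective and 2 (k + 1) |Z| ≤ n!.

module Submission where

open import Defs
open import Data.Bool using (Bool; true; false)
open import Data.Empty using (⊥; ⊥-elim)
open import Data.Sum using (inj₁; inj₂)
open import Data.List using (List; []; _∷_; _++_; _∷ʳ_; length; map; concatMap; take; drop; filter; upTo; applyDownFrom; cartesianProduct)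
open import Data.List.Properties
  using (∷-injectiveˡ; ∷-injectiveʳ; length-++; length-map; length-take; length-drop; length-applyDownFrom; length-upTo;
         take-map; drop-map; take-drop; map-applyDownFrom; applyDownFrom-∷ʳ; filter-accept; filter-reject; filter-all)
open import Data.List.Membership.Propositional using (_∈_; _∉_; find; lose)
open import Data.List.Membership.Propositional.Properties
  using (∈-applyDownFrom⁻; ∈-map⁺; ∈-map⁻; ∈-concatMap⁺; ∈-concatMap⁻; ∈-∃++; ∈-++⁻; ∈-++⁺ˡ; ∈-++⁺ʳ;
         ∈-filter⁻; ∈-cartesianProduct⁻; ∈-upTo⁻)
open import Data.List.Relation.Unary.Any using (here; there)
open import Data.List.Relation.Unary.All as All using (All; []; _∷_)
import Data.List.Relation.Unary.All.Properties as All
open import Data.List.Relation.Unary.Unique.Propositional using (Unique; []; _∷_)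
import Data.List.Relation.Unary.Unique.Propositional.Properties as Unique
open import Data.List.Relation.Binary.Permutation.Propositional
  using (_↭_; prep; swap; ↭-refl; ↭-sym; ↭-trans; ↭⇒↭ₛ; module PermutationReasoning)
import Data.List.Relation.Binary.Permutation.Propositional.Properties as ↭
open import Data.List.Relation.Binary.Permutation.Setoid.Properties as ↭ₛ using ()
open import Data.Nat using (ℕ; zero; suc; _+_; _*_; _∸_; _≤_; _<_; z≤n; s≤s; NonZero; >-nonZero; _>_)
open import Data.Nat.Properties
open import Data.Nat.ListAction using (sum)
open import Data.Product using (_×_; _,_; proj₁; proj₂; map₂; uncurry)
import Data.Integer as ℤ
import Data.Integer.Properties as ℤ
open import Function using (_∘_)
import Algebra.Properties.CommutativeSemigroup +-commutativeSemigroup as +-CS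
open import Relation.Binary.PropositionalEquality
open import Relation.Nullary using (¬?)

length-take-≤ : ∀ {A : Set} n (xs : List A) → n ≤ length xs → length (take n xs) ≡ n
length-take-≤ n xs n≤|xs| = trans (length-take n xs) (m≤n⇒m⊓n≡m n≤|xs|)

length-cartesianProduct : ∀ {A B : Set} (xs : List A) (ys : List B) →
  length (cartesianProduct xs ys) ≡ length xs * length ys
length-cartesianProduct [] ys = refl
length-cartesianProduct (x ∷ xs) ys = begin
  length (map (x ,_) ys ++ cartesianProduct xs ys)        ≡⟨ length-++ (map (x ,_) ys) ⟩
  length (map (x ,_) ys) + length (cartesianProduct xs ys) ≡⟨ cong₂ _+_ (length-map (x ,_) ys) (length-cartesianProduct xs ys) ⟩
  length ys + length xs * length ys                       ∎
  where open ≡-Reasoning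

Unique-resp-↭ : ∀ {A : Set} {xs ys : List A} → xs ↭ ys → Unique xs → Unique ys
Unique-resp-↭ {A} p = ↭ₛ.Unique-resp-↭ (setoid A) (↭⇒↭ₛ p)

Unique-map : ∀ {A B : Set} (f : A → B) {xs} → Unique xs →
  (∀ {x y} → x ∈ xs → y ∈ xs → f x ≡ f y → x ≡ y) → Unique (map f xs)
Unique-map f {[]} _ _ = []
Unique-map f {x ∷ xs} (x∉xs ∷ xs!) f-inj =
  All.map⁺ (All.tabulate (λ y∈ fx≡fy → All.lookup x∉xs y∈ (f-inj (here refl) (there y∈) fx≡fy)))
  ∷ Unique-map f xs! (λ x∈ y∈ → f-inj (there x∈) (there y∈))

Unique-concatMap : ∀ {A B : Set} (f : A → List B) {xs} → Unique xs →
  (∀ {x} → x ∈ xs → Unique (f x)) →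
  (∀ {x y z} → x ∈ xs → y ∈ xs → z ∈ f x → z ∈ f y → x ≡ y) →
  Unique (concatMap f xs)
Unique-concatMap f {[]} _ _ _ = []
Unique-concatMap f {x ∷ xs} (x∉xs ∷ xs!) f-unique f-disjoint =
  Unique.++⁺ (f-unique (here refl))
    (Unique-concatMap f xs! (f-unique ∘ there) (λ x∈ y∈ → f-disjoint (there x∈) (there y∈)))
    (λ (z∈fx , z∈rest) → disjoint z∈fx z∈rest)
  where
  disjoint : ∀ {z} → z ∈ f x → z ∈ concatMap f xs → ⊥
  disjoint z∈fx z∈rest with y , y∈ , z∈fy ← find (∈-concatMap⁻ f {xs = xs} z∈rest)
    with refl ← f-disjoint (here refl) (there y∈) z∈fx z∈fy = All.lookup x∉xs y∈ refl

Unique-⊆⇒length≤ : ∀ {A : Set} {xs ys : List A} → Unique xs → (∀ {z} → z ∈ xs → z ∈ ys) → length xs ≤ length ys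
Unique-⊆⇒length≤ {xs = []} _ _ = z≤n
Unique-⊆⇒length≤ {xs = x ∷ xs} (x∉xs ∷ xs!) xs⊆ys with ps , qs , refl ← ∈-∃++ (xs⊆ys (here refl)) = begin
  suc (length xs)              ≤⟨ s≤s (Unique-⊆⇒length≤ xs! xs⊆ps++qs) ⟩
  suc (length (ps ++ qs))      ≡⟨ cong suc (length-++ ps) ⟩
  suc (length ps + length qs)  ≡⟨ +-suc (length ps) (length qs) ⟨
  length ps + length (x ∷ qs)  ≡⟨ length-++ ps ⟨
  length (ps ++ x ∷ qs)        ∎
  where
  open ≤-Reasoning
  xs⊆ps++qs : ∀ {z} → z ∈ xs → z ∈ ps ++ qs
  xs⊆ps++qs z∈ with ∈-++⁻ ps (xs⊆ys (there z∈))
  ... | inj₁ z∈ps = ∈-++⁺ˡ z∈ps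
  ... | inj₂ (here refl) = ⊥-elim (All.lookup x∉xs z∈ refl)
  ... | inj₂ (there z∈qs) = ∈-++⁺ʳ ps z∈qs

injection⇒length≤ : ∀ {A B : Set} (f : A → B) {xs ys} → Unique xs →
  (∀ {x y} → x ∈ xs → y ∈ xs → f x ≡ f y → x ≡ y) → (∀ {x} → x ∈ xs → f x ∈ ys) →
  length xs ≤ length ys
injection⇒length≤ f {xs} {ys} xs! f-inj f-into = begin
  length xs          ≡⟨ length-map f xs ⟨
  length (map f xs)  ≤⟨ Unique-⊆⇒length≤ (Unique-map f xs! f-inj) image⊆ ⟩
  length ys          ∎
  where
  open ≤-Reasoning
  image⊆ : ∀ {z} → z ∈ map f xs → z ∈ ys
  image⊆ z∈ with _ , x∈ , refl ← ∈-map⁻ f z∈ = f-into x∈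

-- exchange i x ys puts x at index i of ys and returns the entry it displaced; out of range it
-- changes nothing, so that swap₀ i (which exchanges the entries at indices 0 and i) is an
-- involution without side conditions.
exchange : ∀ {A : Set} → ℕ → A → List A → A × List A
exchange i x [] = x , []
exchange zero x (y ∷ ys) = y , x ∷ ys
exchange (suc i) x (y ∷ ys) = map₂ (y ∷_) (exchange i x ys)

swap₀ : ∀ {A : Set} → ℕ → List A → List A
swap₀ zero xs = xs
swap₀ (suc i) [] = []
swap₀ (suc i) (x ∷ ys) = uncurry _∷_ (exchange i x ys)

exchange-involutive : ∀ {A : Set} i (x : A) ys → uncurry (exchange i) (exchange i x ys) ≡ (x , ys)
exchange-involutive i x [] = refl
exchange-involutive zero x (y ∷ ys) = refl
exchange-involutive (suc i) x (y ∷ ys) = cong (map₂ (y ∷_)) (exchange-involutive i x ys)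

swap₀-involutive : ∀ {A : Set} i (xs : List A) → swap₀ i (swap₀ i xs) ≡ xs
swap₀-involutive zero xs = refl
swap₀-involutive (suc i) [] = refl
swap₀-involutive (suc i) (x ∷ ys) = cong (uncurry _∷_) (exchange-involutive i x ys)

swap₀-injective : ∀ {A : Set} i {xs ys : List A} → swap₀ i xs ≡ swap₀ i ys → xs ≡ ys
swap₀-injective i {xs} {ys} eq = begin
  xs                    ≡⟨ swap₀-involutive i xs ⟨
  swap₀ i (swap₀ i xs)  ≡⟨ cong (swap₀ i) eq ⟩
  swap₀ i (swap₀ i ys)  ≡⟨ swap₀-involutive i ys ⟩
  ys                    ∎
  where open ≡-Reasoning

exchange-↭ : ∀ {A : Set} i (x : A) ys → uncurry _∷_ (exchange i x ys) ↭ x ∷ ys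
exchange-↭ i x [] = ↭-refl
exchange-↭ zero x (y ∷ ys) = swap y x ↭-refl
exchange-↭ (suc i) x (y ∷ ys) =
  ↭-trans (swap _ y ↭-refl) (↭-trans (prep y (exchange-↭ i x ys)) (swap y x ↭-refl))

swap₀-↭ : ∀ {A : Set} i (xs : List A) → swap₀ i xs ↭ xs
swap₀-↭ zero xs = ↭-refl
swap₀-↭ (suc i) [] = ↭-refl
swap₀-↭ (suc i) (x ∷ ys) = exchange-↭ i x ys

take-exchange : ∀ {A : Set} {m i} (x : A) ys → m ≤ i → take m (proj₂ (exchange i x ys)) ≡ take m ys
take-exchange x [] _ = refl
take-exchange x (y ∷ ys) z≤n = refl
take-exchange x (y ∷ ys) (s≤s m≤i) = cong (y ∷_) (take-exchange x ys m≤i)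

nth : List ℕ → ℕ → ℕ
nth [] _ = 0
nth (x ∷ _) zero = x
nth (_ ∷ xs) (suc i) = nth xs i

proj₁-exchange : ∀ i x ys → i < length ys → proj₁ (exchange i x ys) ≡ nth ys i
proj₁-exchange zero x (y ∷ ys) _ = refl
proj₁-exchange (suc i) x (y ∷ ys) (s≤s i<|ys|) = proj₁-exchange i x ys i<|ys|

nth-∈ : ∀ xs {i} → i < length xs → nth xs i ∈ xs
nth-∈ (x ∷ xs) {zero} _ = here refl
nth-∈ (x ∷ xs) {suc i} (s≤s i<|xs|) = there (nth-∈ xs i<|xs|)

nth-injective : ∀ {xs} → Unique xs → ∀ {i j} → i < length xs → j < length xs → nth xs i ≡ nth xs j → i ≡ j
nth-injective {x ∷ xs} _ {zero} {zero} _ _ _ = refl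
nth-injective {x ∷ xs} (x∉xs ∷ _) {zero} {suc j} _ (s≤s j<) x≡ = ⊥-elim (All.lookup x∉xs (nth-∈ xs j<) x≡)
nth-injective {x ∷ xs} (x∉xs ∷ _) {suc i} {zero} (s≤s i<) _ ≡x = ⊥-elim (All.lookup x∉xs (nth-∈ xs i<) (sym ≡x))
nth-injective {x ∷ xs} (_ ∷ xs!) {suc i} {suc j} (s≤s i<) (s≤s j<) eq = cong suc (nth-injective xs! i< j< eq)

sum-map-∸ : ∀ {N} xs → All (_≤ N) xs → sum (map (N ∸_) xs) + sum xs ≡ length xs * N
sum-map-∸ [] [] = refl
sum-map-∸ {N} (x ∷ xs) (x≤N ∷ xs≤N) = begin
  (N ∸ x + sum (map (N ∸_) xs)) + (x + sum xs)  ≡⟨ +-CS.interchange (N ∸ x) _ x _ ⟩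
  (N ∸ x + x) + (sum (map (N ∸_) xs) + sum xs)  ≡⟨ cong₂ _+_ (m∸n+n≡m x≤N) (sum-map-∸ xs xs≤N) ⟩
  N + length xs * N                              ∎
  where open ≡-Reasoning

complement-sum : ∀ {N d} p q → All (_≤ N) p → All (_≤ N) q → length p ≡ length q + d → sum p ≡ sum q →
  sum (map (N ∸_) p) ≡ sum (map (N ∸_) q) + d * N
complement-sum {N} {d} p q p≤N q≤N |p|≡|q|+d Σp≡Σq = +-cancelʳ-≡ (sum p) _ _ (begin
  sum (map (N ∸_) p) + sum p              ≡⟨ sum-map-∸ p p≤N ⟩
  length p * N                            ≡⟨ cong (_* N) |p|≡|q|+d ⟩
  (length q + d) * N                      ≡⟨ *-distribʳ-+ N (length q) d ⟩
  length q * N + d * N                    ≡⟨ cong (_+ d * N) (sum-map-∸ q q≤N) ⟨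
  (sum (map (N ∸_) q) + sum q) + d * N    ≡⟨ +-CS.xy∙z≈xz∙y (sum (map (N ∸_) q)) (sum q) (d * N) ⟩
  (sum (map (N ∸_) q) + d * N) + sum q    ≡⟨ cong (_ +_) Σp≡Σq ⟨
  (sum (map (N ∸_) q) + d * N) + sum p    ∎)
  where open ≡-Reasoning

map-∸-involutive : ∀ {N} xs → All (_≤ N) xs → map (N ∸_) (map (N ∸_) xs) ≡ xs
map-∸-involutive [] [] = refl
map-∸-involutive (x ∷ xs) (x≤N ∷ xs≤N) = cong₂ _∷_ (m∸[m∸n]≡n x≤N) (map-∸-involutive xs xs≤N)

map-suc-∸ : ∀ {n} xs → All (_≤ n) xs → map (suc n ∸_) xs ≡ map suc (map (n ∸_) xs)
map-suc-∸ [] [] = refl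
map-suc-∸ (x ∷ xs) (x≤n ∷ xs≤n) = cong₂ _∷_ (+-∸-assoc 1 x≤n) (map-suc-∸ xs xs≤n)

values : ℕ → List ℕ
values = applyDownFrom suc

∈-values⇒≤ : ∀ {n x} → x ∈ values n → x ≤ n
∈-values⇒≤ x∈ with _ , i<n , refl ← ∈-applyDownFrom⁻ suc x∈ = i<n

values-unique : ∀ n → Unique (values n)
values-unique n = Unique.applyDownFrom⁺₁ suc n (λ j<i _ eq → <⇒≢ j<i (sym (suc-injective eq)))

↭values⇒length : ∀ {n σ} → σ ↭ values n → length σ ≡ n
↭values⇒length {n} p = trans (↭.↭-length p) (length-applyDownFrom suc n)

↭values⇒≤ : ∀ {n σ} → σ ↭ values n → All (_≤ n) σ
↭values⇒≤ p = ↭.All-resp-↭ (↭-sym p) (All.tabulate ∈-values⇒≤)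

↭values⇒unique : ∀ {n σ} → σ ↭ values n → Unique σ
↭values⇒unique {n} p = Unique-resp-↭ (↭-sym p) (values-unique n)

map-∸-values : ∀ n → map (suc n ∸_) (values n) ↭ values n
map-∸-values zero = ↭-refl
map-∸-values (suc n) = begin
  map (2 + n ∸_) (values (suc n))                ≡⟨ cong₂ _∷_ (m+n∸n≡m 1 n) (map-suc-∸ (values n) values≤) ⟩
  1 ∷ map suc (map (suc n ∸_) (values n))        ↭⟨ prep 1 (↭.map⁺ suc (map-∸-values n)) ⟩
  1 ∷ map suc (values n)                         ↭⟨ ↭.∷↭∷ʳ 1 (map suc (values n)) ⟩
  map suc (values n) ∷ʳ 1                        ≡⟨ cong (_∷ʳ 1) (map-applyDownFrom suc suc n) ⟩
  applyDownFrom (suc ∘ suc) n ∷ʳ 1               ≡⟨ applyDownFrom-∷ʳ suc n ⟩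
  values (suc n)                                 ∎
  where
  open PermutationReasoning
  values≤ : All (_≤ suc n) (values n)
  values≤ = All.tabulate (m≤n⇒m≤1+n ∘ ∈-values⇒≤)

∈-insertions⇒↭ : ∀ {x ys ρ} → ρ ∈ insertions x ys → ρ ↭ x ∷ ys
∈-insertions⇒↭ {ys = []} (here refl) = ↭-refl
∈-insertions⇒↭ {ys = y ∷ ys} (here refl) = ↭-refl
∈-insertions⇒↭ {x} {y ∷ ys} (there ρ∈) with _ , ρ'∈ , refl ← ∈-map⁻ (y ∷_) ρ∈ =
  ↭-trans (prep y (∈-insertions⇒↭ ρ'∈)) (swap y x ↭-refl)

∈-perms⇒↭ : ∀ {n σ} → σ ∈ perms n → σ ↭ values n
∈-perms⇒↭ {zero} (here refl) = ↭-refl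
∈-perms⇒↭ {suc n} σ∈ with _ , τ∈ , σ∈ins ← find (∈-concatMap⁻ (insertions (suc n)) {xs = perms n} σ∈) =
  ↭-trans (∈-insertions⇒↭ σ∈ins) (prep (suc n) (∈-perms⇒↭ τ∈))

++-∷-∈-insertions : ∀ (x : ℕ) ps qs → ps ++ x ∷ qs ∈ insertions x (ps ++ qs)
++-∷-∈-insertions x [] [] = here refl
++-∷-∈-insertions x [] (q ∷ qs) = here refl
++-∷-∈-insertions x (p ∷ ps) qs = there (∈-map⁺ (p ∷_) (++-∷-∈-insertions x ps qs))

↭⇒∈-perms : ∀ {n σ} → σ ↭ values n → σ ∈ perms n
↭⇒∈-perms {zero} p rewrite ↭.↭-empty-inv p = here refl
↭⇒∈-perms {suc n} p with ps , qs , refl ← ∈-∃++ (↭.∈-resp-↭ (↭-sym p) (here refl)) =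
  ∈-concatMap⁺ (insertions (suc n)) {xs = perms n}
    (lose (↭⇒∈-perms (↭.drop-mid ps [] p)) (++-∷-∈-insertions (suc n) ps qs))

remove : ℕ → List ℕ → List ℕ
remove x = filter (λ y → ¬? (y ≟ x))

remove-insertions : ∀ {x ys ρ} → x ∉ ys → ρ ∈ insertions x ys → remove x ρ ≡ ys
remove-insertions {x} {[]} _ (here refl) = filter-reject (λ y → ¬? (y ≟ x)) (λ x≢x → x≢x refl)
remove-insertions {x} {y ∷ ys} x∉ (here refl) =
  trans (filter-reject (λ y → ¬? (y ≟ x)) (λ x≢x → x≢x refl))
        (filter-all (λ y → ¬? (y ≟ x)) (All.map (λ x≢z z≡x → x≢z (sym z≡x)) (All.¬Any⇒All¬ _ x∉)))
remove-insertions {x} {y ∷ ys} x∉ (there ρ∈) with _ , ρ'∈ , refl ← ∈-map⁻ (y ∷_) ρ∈ =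
  trans (filter-accept (λ y → ¬? (y ≟ x)) (λ y≡x → x∉ (here (sym y≡x))))
        (cong (y ∷_) (remove-insertions (x∉ ∘ there) ρ'∈))

insertions-unique : ∀ {x ys} → x ∉ ys → Unique (insertions x ys)
insertions-unique {ys = []} _ = [] ∷ []
insertions-unique {x} {y ∷ ys} x∉ =
  All.map⁺ (All.tabulate (λ _ x∷≡y∷ → x∉ (here (∷-injectiveˡ x∷≡y∷))))
  ∷ Unique.map⁺ ∷-injectiveʳ (insertions-unique (x∉ ∘ there))

perms-unique : ∀ n → Unique (perms n)
perms-unique zero = [] ∷ []
perms-unique (suc n) =
  Unique-concatMap (insertions (suc n)) (perms-unique n)
    (insertions-unique ∘ fresh)
    (λ σ∈ τ∈ ρ∈ ρ∈' → trans (sym (remove-insertions (fresh σ∈) ρ∈)) (remove-insertions (fresh τ∈) ρ∈'))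
  where
  fresh : ∀ {σ} → σ ∈ perms n → suc n ∉ σ
  fresh σ∈ n+1∈ = <-irrefl refl (∈-values⇒≤ (↭.∈-resp-↭ (∈-perms⇒↭ σ∈) n+1∈))

module ZeroCount (a' b d k : ℕ) (a≡b+d : suc a' ≡ b + d) .{{_ : NonZero d}} where

  a m n N : ℕ
  a = suc a'
  m = a' + b
  n = a + b + k
  N = suc n

  sumA sumB : List ℕ → ℕ
  sumA ρ = sum (take a ρ)
  sumB ρ = sum (take b (drop a ρ))

  excess : Bool → ℕ
  excess false = 0
  excess true = d * N

  Balanced : Bool → List ℕ → Set
  Balanced e ρ = sumA ρ ≡ sumB ρ + excess e

  complementIf : Bool → List ℕ → List ℕ
  complementIf false σ = σ
  complementIf true σ = map (N ∸_) σ

  ↭values⇒≤N : ∀ {σ} → σ ↭ values n → All (_≤ N) σ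
  ↭values⇒≤N = All.map m≤n⇒m≤1+n ∘ ↭values⇒≤

  complementIf-↭ : ∀ e {σ} → σ ↭ values n → complementIf e σ ↭ values n
  complementIf-↭ false σ↭ = σ↭
  complementIf-↭ true σ↭ = ↭-trans (↭.map⁺ (N ∸_) σ↭) (map-∸-values n)

  complementIf-injective : ∀ e {σ σ'} → σ ↭ values n → σ' ↭ values n →
    complementIf e σ ≡ complementIf e σ' → σ ≡ σ'
  complementIf-injective false _ _ eq = eq
  complementIf-injective true {σ} {σ'} σ↭ σ'↭ eq = begin
    σ                            ≡⟨ map-∸-involutive σ (↭values⇒≤N σ↭) ⟨
    map (N ∸_) (map (N ∸_) σ)    ≡⟨ cong (map (N ∸_)) eq ⟩
    map (N ∸_) (map (N ∸_) σ')   ≡⟨ map-∸-involutive σ' (↭values⇒≤N σ'↭) ⟩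
    σ'                           ∎
    where open ≡-Reasoning

  complement-balanced : ∀ {σ} → σ ↭ values n → Balanced false σ → Balanced true (map (N ∸_) σ)
  complement-balanced {σ} σ↭ bal = begin
    sum (take a (map (N ∸_) σ))   ≡⟨ cong sum (take-map a σ) ⟩
    sum (map (N ∸_) p)            ≡⟨ complement-sum p q (All.take⁺ a σ≤N) (All.take⁺ b (All.drop⁺ a σ≤N))
                                                      |p|≡|q|+d (trans bal (+-identityʳ (sum q))) ⟩
    sum (map (N ∸_) q) + d * N    ≡⟨ cong (λ xs → sum xs + d * N) take-drop-map ⟨
    sumB (map (N ∸_) σ) + d * N   ∎
    where
    open ≡-Reasoning
    p = take a σ
    q = take b (drop a σ)
    σ≤N = ↭values⇒≤N σ↭
    take-drop-map : take b (drop a (map (N ∸_) σ)) ≡ map (N ∸_) q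
    take-drop-map = trans (cong (take b) (drop-map a σ)) (take-map b (drop a σ))
    |σ|≡a+[b+k] : length σ ≡ a + (b + k)
    |σ|≡a+[b+k] = trans (↭values⇒length σ↭) (+-assoc a b k)
    |drop-a-σ|≡b+k : length (drop a σ) ≡ b + k
    |drop-a-σ|≡b+k = trans (length-drop a σ) (trans (cong (_∸ a) |σ|≡a+[b+k]) (m+n∸m≡n a (b + k)))
    |p|≡|q|+d : length p ≡ length q + d
    |p|≡|q|+d = begin
      length p      ≡⟨ length-take-≤ a σ (subst (a ≤_) (sym |σ|≡a+[b+k]) (m≤m+n a (b + k))) ⟩
      a             ≡⟨ a≡b+d ⟩
      b + d         ≡⟨ cong (_+ d) (length-take-≤ b (drop a σ) (subst (b ≤_) (sym |drop-a-σ|≡b+k) (m≤m+n b k))) ⟨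
      length q + d  ∎

  -- The k + 1 (0-based) indices whose entry may be exchanged with the first one: 0 itself and
  -- a + b, …, n - 1, which lie outside both blocks.
  slot : ℕ → ℕ
  slot zero = zero
  slot (suc t) = suc (m + t)

  slot<n : ∀ {t} → t ≤ k → slot t < n
  slot<n {zero} _ = s≤s z≤n
  slot<n {suc t} t<k = s≤s (+-monoʳ-< m t<k)

  slot-injective : ∀ {t t'} → slot t ≡ slot t' → t ≡ t'
  slot-injective {zero} {zero} _ = refl
  slot-injective {suc t} {suc t'} eq = cong suc (+-cancelˡ-≡ m t t' (suc-injective eq))

  sumA-swap : ∀ t x ys → slot t < length (x ∷ ys) →
    sumA (swap₀ (slot t) (x ∷ ys)) ≡ nth (x ∷ ys) (slot t) + sum (take a' ys)
  sumA-swap zero x ys _ = refl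
  sumA-swap (suc t) x ys (s≤s m+t<|ys|) =
    cong₂ _+_ (proj₁-exchange (m + t) x ys m+t<|ys|)
              (cong sum (take-exchange x ys (≤-trans (m≤m+n a' b) (m≤m+n m t))))

  sumB-swap : ∀ t ρ → sumB (swap₀ (slot t) ρ) ≡ sumB ρ
  sumB-swap zero ρ = refl
  sumB-swap (suc t) [] = refl
  sumB-swap (suc t) (x ∷ ys) = cong sum (begin
    take b (drop a' zs)       ≡⟨ take-drop b a' zs ⟩
    drop a' (take m zs)       ≡⟨ cong (drop a') (take-exchange x ys (m≤m+n m t)) ⟩
    drop a' (take m ys)       ≡⟨ take-drop b a' ys ⟨
    take b (drop a' ys)       ∎)
    where
    open ≡-Reasoning
    zs = proj₂ (exchange (m + t) x ys)

  excess-gap : ∀ {X Y A B} → X + A ≡ B + excess false → Y + A ≡ B + excess true → n < Y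
  excess-gap {X} {Y} {A} {B} bal bal' = begin-strict
    n           <⟨ n<1+n n ⟩
    N           ≤⟨ m≤n*m N d ⟩
    d * N       ≤⟨ m≤n+m (d * N) X ⟩
    X + d * N   ≡⟨ Y≡X+dN ⟨
    Y           ∎
    where
    open ≤-Reasoning
    Y≡X+dN : Y ≡ X + d * N
    Y≡X+dN = +-cancelʳ-≡ A Y (X + d * N) (≡.begin
      Y + A            ≡.≡⟨ bal' ⟩
      B + d * N        ≡.≡⟨ cong (_+ d * N) (trans (sym (+-identityʳ B)) (sym bal)) ⟩
      X + A + d * N    ≡.≡⟨ +-CS.xy∙z≈xz∙y X A (d * N) ⟩
      X + d * N + A    ≡.∎)
      where module ≡ = ≡-Reasoning

  excess-determines : ∀ e e' {X Y A B} → X + A ≡ B + excess e → Y + A ≡ B + excess e' →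
    X ≤ n → Y ≤ n → e ≡ e' × X ≡ Y
  excess-determines false false {X} {Y} {A} bal bal' _ _ = refl , +-cancelʳ-≡ A X Y (trans bal (sym bal'))
  excess-determines true true {X} {Y} {A} bal bal' _ _ = refl , +-cancelʳ-≡ A X Y (trans bal (sym bal'))
  excess-determines false true bal bal' _ Y≤n = ⊥-elim (<⇒≱ (excess-gap bal bal') Y≤n)
  excess-determines true false bal bal' X≤n _ = ⊥-elim (<⇒≱ (excess-gap bal' bal) X≤n)

  slot<length : ∀ {τ t} → τ ↭ values n → t ≤ k → slot t < length τ
  slot<length τ↭ t≤k = ≤-trans (slot<n t≤k) (≤-reflexive (sym (↭values⇒length τ↭)))

  slot-entry≤n : ∀ {τ t} → τ ↭ values n → t ≤ k → nth τ (slot t) ≤ n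
  slot-entry≤n {τ} τ↭ t≤k = All.lookup (↭values⇒≤ τ↭) (nth-∈ τ (slot<length τ↭ t≤k))

  balanced-swap⇒ : ∀ e t {x ys} → x ∷ ys ↭ values n → t ≤ k → Balanced e (swap₀ (slot t) (x ∷ ys)) →
    nth (x ∷ ys) (slot t) + sum (take a' ys) ≡ sumB (x ∷ ys) + excess e
  balanced-swap⇒ e t {x} {ys} τ↭ t≤k bal = begin
    nth (x ∷ ys) (slot t) + sum (take a' ys)   ≡⟨ sumA-swap t x ys (slot<length τ↭ t≤k) ⟨
    sumA (swap₀ (slot t) (x ∷ ys))             ≡⟨ bal ⟩
    sumB (swap₀ (slot t) (x ∷ ys)) + excess e  ≡⟨ cong (_+ excess e) (sumB-swap t (x ∷ ys)) ⟩
    sumB (x ∷ ys) + excess e                   ∎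
    where open ≡-Reasoning

  swap-balanced-determines : ∀ e e' t t' {τ} → τ ↭ values n → t ≤ k → t' ≤ k →
    Balanced e (swap₀ (slot t) τ) → Balanced e' (swap₀ (slot t') τ) → e ≡ e' × t ≡ t'
  swap-balanced-determines _ _ _ _ {[]} τ↭ _ _ _ _ with () ← ↭values⇒length τ↭
  swap-balanced-determines e e' t t' {τ@(_ ∷ _)} τ↭ t≤k t'≤k bal bal'
    with refl , same-entry ← excess-determines e e' (balanced-swap⇒ e t τ↭ t≤k bal) (balanced-swap⇒ e' t' τ↭ t'≤k bal')
                               (slot-entry≤n τ↭ t≤k) (slot-entry≤n τ↭ t'≤k)
    = refl , slot-injective (nth-injective (↭values⇒unique τ↭) (slot<length τ↭ t≤k) (slot<length τ↭ t'≤k)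
                                           same-entry)

  Z : List (List ℕ)
  Z = filter (λ σ → D a b σ ℤ.≟ ℤ.+ 0) (perms n)

  ∈Z⇒↭ : ∀ {σ} → σ ∈ Z → σ ↭ values n
  ∈Z⇒↭ σ∈ = ∈-perms⇒↭ (proj₁ (∈-filter⁻ _ {xs = perms n} σ∈))

  ∈Z⇒balanced : ∀ e {σ} → σ ∈ Z → Balanced e (complementIf e σ)
  ∈Z⇒balanced false σ∈ = trans (ℤ.+-injective (ℤ.i-j≡0⇒i≡j _ _ D≡0)) (sym (+-identityʳ _))
    where D≡0 = proj₂ (∈-filter⁻ _ {xs = perms n} σ∈)
  ∈Z⇒balanced true σ∈ = complement-balanced (∈Z⇒↭ σ∈) (∈Z⇒balanced false σ∈)

  orientations : List Bool
  orientations = true ∷ false ∷ []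

  labels : List (Bool × ℕ)
  labels = cartesianProduct orientations (upTo (suc k))

  length-labels : length labels ≡ 2 * suc k
  length-labels = trans (length-cartesianProduct orientations (upTo (suc k))) (cong (2 *_) (length-upTo (suc k)))

  domain : List (List ℕ × Bool × ℕ)
  domain = cartesianProduct Z labels

  embed : List ℕ × Bool × ℕ → List ℕ
  embed (σ , e , t) = swap₀ (slot t) (complementIf e σ)

  ∈domain⇒ : ∀ {σ e t} → (σ , e , t) ∈ domain → σ ∈ Z × t ≤ k
  ∈domain⇒ x∈ with σ∈ , label∈ ← ∈-cartesianProduct⁻ Z labels x∈
                 with _ , t∈ ← ∈-cartesianProduct⁻ orientations (upTo (suc k)) label∈
                 = σ∈ , ≤-pred (∈-upTo⁻ t∈)

  embed-↭ : ∀ {x} → x ∈ domain → embed x ↭ values n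
  embed-↭ {σ , e , t} x∈ = ↭-trans (swap₀-↭ (slot t) _) (complementIf-↭ e (∈Z⇒↭ (proj₁ (∈domain⇒ x∈))))

  swap-embed-balanced : ∀ e t {σ} → σ ∈ Z → Balanced e (swap₀ (slot t) (embed (σ , e , t)))
  swap-embed-balanced e t σ∈ = subst (Balanced e) (sym (swap₀-involutive (slot t) _)) (∈Z⇒balanced e σ∈)

  embed-injective : ∀ {x y} → x ∈ domain → y ∈ domain → embed x ≡ embed y → x ≡ y
  embed-injective {σ , e , t} {σ' , e' , t'} x∈ y∈ eq
    with σ∈ , t≤k ← ∈domain⇒ x∈ | σ'∈ , t'≤k ← ∈domain⇒ y∈
    with refl , refl ← swap-balanced-determines e e' t t' (embed-↭ x∈) t≤k t'≤k
                         (swap-embed-balanced e t σ∈)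
                         (subst (λ τ → Balanced e' (swap₀ (slot t') τ)) (sym eq) (swap-embed-balanced e' t' σ'∈))
    = cong (_, e , t) (complementIf-injective e (∈Z⇒↭ σ∈) (∈Z⇒↭ σ'∈) (swap₀-injective (slot t) eq))

  domain-unique : Unique domain
  domain-unique = Unique.cartesianProduct⁺ (Unique.filter⁺ _ (perms-unique n))
    (Unique.cartesianProduct⁺ (((λ ()) ∷ []) ∷ [] ∷ []) (Unique.upTo⁺ (suc k)))

  length-Z-bound : length Z * (2 * suc k) ≤ length (perms n)
  length-Z-bound = begin
    length Z * (2 * suc k)   ≡⟨ cong (length Z *_) length-labels ⟨
    length Z * length labels ≡⟨ length-cartesianProduct Z labels ⟨
    length domain            ≤⟨ injection⇒length≤ embed domain-unique embed-injective (↭⇒∈-perms ∘ embed-↭) ⟩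
    length (perms n)         ∎
    where open ≤-Reasoning

lemma7 : (n a b : ℕ) → 0 < a → 0 < b → a + b < n → a > b →
    2 * (n ∸ (a + b) + 1) * countZero n a b ≤ length (perms n)
lemma7 n a@(suc a') b _ _ a+b<n b<a = subst Bound (m+[n∸m]≡n (<⇒≤ a+b<n)) bound
  where
  k = n ∸ (a + b)

  Bound : ℕ → Set
  Bound n = 2 * (n ∸ (a + b) + 1) * countZero n a b ≤ length (perms n)

  instance
    a∸b≢0 : NonZero (a ∸ b)
    a∸b≢0 = >-nonZero (m<n⇒0<n∸m b<a)

  bound : Bound (a + b + k)
  bound = begin
    2 * (a + b + k ∸ (a + b) + 1) * zeros  ≡⟨ cong (λ l → 2 * (l + 1) * zeros) (m+n∸m≡n (a + b) k) ⟩
    2 * (k + 1) * zeros                    ≡⟨ cong (λ l → 2 * l * zeros) (+-comm k 1) ⟩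
    2 * suc k * zeros                      ≡⟨ *-comm (2 * suc k) zeros ⟩
    zeros * (2 * suc k)                    ≤⟨ ZeroCount.length-Z-bound a' b (a ∸ b) k a≡b+[a∸b] ⟩
    length (perms (a + b + k))             ∎
    where
    open ≤-Reasoning
    zeros = countZero (a + b + k) a b
    a≡b+[a∸b] : a ≡ b + (a ∸ b)
    a≡b+[a∸b] = sym (m+[n∸m]≡n (<⇒≤ b<a))
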